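{- For integers $n,m\ge1$ and $1\le r\le m$, define $(n,m,r)^*=(n',m',r')$ where $n'=(r,m)$, $m'=\frac{mn}{(r,m)}$, $r'=n\left(\frac{m}{(r,m)}-k\right)$, and $k$ is the unique integer with $0\le k\le \frac{m}{(r,m)}-1$ and $rk\equiv (r,m) \pmod m$. Then $((n,m,r)^*)^*=(n,m,r)$; that is, with $k'$ the unique integer with $0\le k'\le \frac{m'}{(r',m')}-1$ and $r'k'\equiv (r',m')\pmod{m'}$, one has $(r',m')=n$, $\frac{m'n'}{(r',m')}=m$ and $n'\left(\frac{m'}{(r',m')}-k'\right)=r$. Equivalently, $T^{**}(n,m,r)=T(n,m,r)$, where $T^*(n,m,r)=T(n',m',r')$.
   Context: $(a,b)$ denotes the greatest common divisor of $a$ and $b$. $T(n,m,r)$ denotes the quadriculated torus obtained from an $n\times m$ chessboard by gluing left and right sides and gluing top and bottom with a torsion of $r$ squares (vertices $v_{i,j}$, $i\in Z_n$, $j\in Z_m$, with $v_{i,j}\sim v_{i,j+1}$, $v_{i,j}\sim v_{i+1,j}$ for $i\le n-2$, and $v_{n-1,j}\sim v_{0,j+r}$). -}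

module Defs where

open import Data.Nat using (ℕ; zero; suc; _+_; _*_; _∸_; _≤_)
open import Data.Nat.DivMod using (_/_)
open import Data.Nat.GCD using (gcd)
open import Data.Integer using (ℤ; +_; _-_)
open import Data.Integer.Divisibility using (_∣_)
open import Data.Product using (_×_)

-- Natural-number division a / b, with the (never used here) convention a div 0 = 0.
-- In the statement it is only applied with divisor (r,m) ≥ 1 (as m ≥ 1) and
-- exact quotients.
_div_ : ℕ → ℕ → ℕ
a div zero = 0
a div suc b = a / suc b

infix 4 _≡_[mod_]
_≡_[mod_] : ℕ → ℕ → ℕ → Set
a ≡ b [mod m ] = (+ m) ∣ ((+ a) - (+ b))

IsK : ℕ → ℕ → ℕ → Set
IsK r m k = (k ≤ (m div gcd r m) ∸ 1) × ((r * k) ≡ (gcd r m) [mod m ])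

star-n : ℕ → ℕ → ℕ → ℕ
star-n n m r = gcd r m

star-m : ℕ → ℕ → ℕ → ℕ
star-m n m r = (m * n) div gcd r m

star-r : ℕ → ℕ → ℕ → ℕ → ℕ
star-r n m r k = n * ((m div gcd r m) ∸ k)

module Submission where

-- Write g = (r,m), r = g b and m = g a, so that (b,a) = 1.  Cancelling g, the
-- conditions on k say that k is the inverse of b modulo a taken in [0, a).  Then
-- n' = g, m' = n a and r' = n (a - k).  As (a - k)(a - b) ≡ b k ≡ 1 (mod a), the
-- number a - k is prime to a, so (r',m') = n and m'/(r',m') = a, and k' is the
-- inverse of a - k modulo a in [0, a), namely a - b.  Hence (r',m') = n,
-- m'n'/(r',m') = a g = m and n'(a - k') = g b = r.

open import Defs
open import Data.Nat
  using (ℕ; zero; suc; _+_; _*_; _∸_; _≤_; _<_; s≤s; s≤s⁻¹; NonZero; >-nonZero; ≢-nonZero; ≢-nonZero⁻¹)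
open import Data.Nat.Properties
  using (≤-<-trans; ⊔-pres-<m; m∸n+n≡m; ∸-monoʳ-<; m∸[m∸n]≡n; <⇒≤;
         *-comm; *-identityʳ; *-assoc; *-distribˡ-+; *-distribʳ-+)
open import Data.Nat.DivMod
  using (_/_; _%_; m≡m%n+[m/n]*n; m%n<n; m*[n/m]≡n; m*n/n≡m; /-congˡ; /-monoˡ-≤; m≥n⇒m/n>0)
import Data.Nat.Divisibility as ℕ
open import Data.Nat.GCD
  using (gcd; gcd[m,n]∣m; gcd[m,n]∣n; gcd[m,n]≢0; c*gcd[m,n]≡gcd[cm,cn]; n/gcd[m,n]≢0; module Bézout)
open import Data.Nat.Coprimality using (Coprime; coprime-Bézout; coprime-/gcd; coprime⇒gcd≡1)
open import Data.Nat.Tactic.RingSolver using () renaming (solve-∀ to ℕ-solve)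
open import Data.Integer as ℤ using (ℤ; +_)
open import Data.Integer.Properties
  using (+-injective; pos-*; pos-+; +-inverseʳ; [+m]-[+n]≡m⊖n; ∣m⊝n∣≤m⊔n; ∣i∣≡0⇒i≡0; i-j≡0⇒i≡j)
open import Data.Integer.Divisibility.Signed
  using (_∣_; ∣ᵤ⇒∣; ∣⇒∣ᵤ; ∣-refl; ∣-trans; ∣m∣n⇒∣m-n; ∣m∣n⇒∣m+n; ∣m+n∣n⇒∣m; ∣n⇒∣m*n;
         *-cancelˡ-∣; *-monoʳ-∣)
open import Data.Integer.Tactic.RingSolver using () renaming (solve-∀ to ℤ-solve)
open import Data.Product using (Σ; ∃; _×_; _,_; map; map₂)
open import Data.Sum using (inj₂)
open import Function.Bundles using (_⇔_; mk⇔; module Equivalence)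
import Function.Properties.Equivalence as ⇔
open import Relation.Binary.PropositionalEquality
  using (_≡_; refl; sym; trans; cong; cong₂; subst; subst₂; module ≡-Reasoning)
open import Relation.Nullary using (contradiction)

open ≡-Reasoning
open Equivalence using (to; from)

-- x ≡ y [mod a ] unfolds to a divisibility of absolute values, from which Agda
-- cannot recover x, y and a; hence these are passed explicitly below.
≡-mod⇒∣ : ∀ {a x y} → x ≡ y [mod a ] → + a ∣ + x ℤ.- + y
≡-mod⇒∣ {a} {x} {y} = ∣ᵤ⇒∣ {+ a} {+ x ℤ.- + y}

∣⇒≡-mod : ∀ {a x y} → + a ∣ + x ℤ.- + y → x ≡ y [mod a ]
∣⇒≡-mod = ∣⇒∣ᵤ

≡-mod-refl : ∀ {a} x → x ≡ x [mod a ]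
≡-mod-refl {a} x = subst (a ℕ.∣_) (cong ℤ.∣_∣ (sym (+-inverseʳ (+ x)))) (a ℕ.∣0)

≡-mod-cong : ∀ {a a′ x x′ y y′} → x ≡ x′ → y ≡ y′ → a ≡ a′ →
             x ≡ y [mod a ] ⇔ x′ ≡ y′ [mod a′ ]
≡-mod-cong refl refl refl = ⇔.refl

+-multiple-≡-mod⇔ : ∀ x k a y → x + k * a ≡ y [mod a ] ⇔ x ≡ y [mod a ]
+-multiple-≡-mod⇔ x k a y = mk⇔
  (λ h → ∣⇒≡-mod {a} {x} {y}
    (∣m+n∣n⇒∣m (subst (+ a ∣_) shift (≡-mod⇒∣ {a} {x + k * a} {y} h)) ka))
  (λ h → ∣⇒≡-mod {a} {x + k * a} {y}
    (subst (+ a ∣_) (sym shift) (∣m∣n⇒∣m+n (≡-mod⇒∣ {a} {x} {y} h) ka)))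
  where
  ka : + a ∣ + k ℤ.* + a
  ka = ∣n⇒∣m*n (+ k) ∣-refl
  shift : + (x + k * a) ℤ.- + y ≡ (+ x ℤ.- + y) ℤ.+ + k ℤ.* + a
  shift = trans (cong (ℤ._- + y) (trans (pos-+ x (k * a)) (cong (λ z → + x ℤ.+ z) (pos-* k a))))
                (ring (+ x) (+ y) (+ k ℤ.* + a))
    where
    ring : ∀ (x y z : ℤ) → x ℤ.+ z ℤ.- y ≡ (x ℤ.- y) ℤ.+ z
    ring = ℤ-solve

≡-mod-*ˡ⇔ : ∀ c {x y a} .{{_ : NonZero c}} → c * x ≡ c * y [mod c * a ] ⇔ x ≡ y [mod a ]
≡-mod-*ˡ⇔ c {x} {y} {a} = mk⇔
  (λ h → ∣⇒≡-mod {a} {x} {y}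
    (*-cancelˡ-∣ (+ c) (subst₂ _∣_ (pos-* c a) factor (≡-mod⇒∣ {c * a} {c * x} {c * y} h))))
  (λ h → ∣⇒≡-mod {c * a} {c * x} {c * y}
    (subst₂ _∣_ (sym (pos-* c a)) (sym factor) (*-monoʳ-∣ (+ c) (≡-mod⇒∣ {a} {x} {y} h))))
  where
  factor : + (c * x) ℤ.- + (c * y) ≡ + c ℤ.* (+ x ℤ.- + y)
  factor = trans (cong₂ ℤ._-_ (pos-* c x) (pos-* c y)) (ring (+ c) (+ x) (+ y))
    where
    ring : ∀ (c x y : ℤ) → c ℤ.* x ℤ.- c ℤ.* y ≡ c ℤ.* (x ℤ.- y)
    ring = ℤ-solve

∣-<⇒≡0 : ∀ {a d} → a ℕ.∣ d → d < a → d ≡ 0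
∣-<⇒≡0 {d = zero}  _   _   = refl
∣-<⇒≡0 {d = suc _} a∣d d<a = contradiction a∣d (ℕ.>⇒∤ d<a)

≡-mod⇒≡ : ∀ {a i j} → i < a → j < a → i ≡ j [mod a ] → i ≡ j
≡-mod⇒≡ {a} {i} {j} i<a j<a a∣∣i-j∣ =
  +-injective (i-j≡0⇒i≡j (+ i) (+ j) (∣i∣≡0⇒i≡0 (∣-<⇒≡0 a∣∣i-j∣ ∣i-j∣<a)))
  where
  ∣i-j∣<a : ℤ.∣ + i ℤ.- + j ∣ < a
  ∣i-j∣<a = subst (_< a) (cong ℤ.∣_∣ (sym ([+m]-[+n]≡m⊖n i j)))
                  (≤-<-trans (∣m⊝n∣≤m⊔n i j) (⊔-pres-<m i<a j<a))

inverses-≡-mod : ∀ {a y k k′} → y * k ≡ 1 [mod a ] → y * k′ ≡ 1 [mod a ] → k ≡ k′ [mod a ]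
inverses-≡-mod {a} {y} {k} {k′} yk≡1 yk′≡1 = ∣⇒≡-mod {a} {k} {k′} (subst (+ a ∣_) identity
  (∣m∣n⇒∣m-n (∣n⇒∣m*n (+ k′) (≡-mod⇒∣ {a} {y * k} {1} yk≡1))
             (∣n⇒∣m*n (+ k) (≡-mod⇒∣ {a} {y * k′} {1} yk′≡1))))
  where
  identity : + k′ ℤ.* (+ (y * k) ℤ.- + 1) ℤ.- + k ℤ.* (+ (y * k′) ℤ.- + 1) ≡ + k ℤ.- + k′
  identity = trans (cong₂ (λ u v → + k′ ℤ.* (u ℤ.- + 1) ℤ.- + k ℤ.* (v ℤ.- + 1))
                          (pos-* y k) (pos-* y k′))
                   (ring (+ y) (+ k) (+ k′))
    where
    ring : ∀ (y k k′ : ℤ) → k′ ℤ.* (y ℤ.* k ℤ.- + 1) ℤ.- k ℤ.* (y ℤ.* k′ ℤ.- + 1) ≡ k ℤ.- k′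
    ring = ℤ-solve

invertible⇒coprime : ∀ {a y k} → y * k ≡ 1 [mod a ] → Coprime y a
invertible⇒coprime {a} {y} {k} yk≡1 {d} (d∣y , d∣a) =
  ℕ.∣1⇒≡1 (∣⇒∣ᵤ (subst (+ d ∣_) (cancel (+ (y * k))) (∣m∣n⇒∣m-n d∣yk d∣yk-1)))
  where
  d∣yk : + d ∣ + (y * k)
  d∣yk = ∣ᵤ⇒∣ {+ d} {+ (y * k)} (ℕ.∣m⇒∣m*n k d∣y)
  d∣yk-1 : + d ∣ + (y * k) ℤ.- + 1
  d∣yk-1 = ∣-trans (∣ᵤ⇒∣ {+ d} {+ a} d∣a) (≡-mod⇒∣ {a} {y * k} {1} yk≡1)
  cancel : ∀ (x : ℤ) → x ℤ.- (x ℤ.- + 1) ≡ + 1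
  cancel = ℤ-solve

coprime⇒invertible : ∀ {a y} .{{_ : NonZero a}} → Coprime y a → ∃ λ k → y * k ≡ 1 [mod a ]
coprime⇒invertible {a@(suc a′)} {y} coprime with coprime-Bézout coprime
... | Bézout.+- x z 1+za≡xy = x , subst (λ w → w ≡ 1 [mod a ]) (trans 1+za≡xy (*-comm x y))
  (from (+-multiple-≡-mod⇔ 1 z a 1) (≡-mod-refl 1))
-- Here y x ≡ -1, so x (a - 1) is an inverse of y.
... | Bézout.-+ x z 1+xy≡za = x * a′ , to (+-multiple-≡-mod⇔ (y * (x * a′)) z a 1)
  (subst (λ w → w ≡ 1 [mod a ]) (sym identity) (from (+-multiple-≡-mod⇔ 1 (x * y) a 1) (≡-mod-refl 1)))
  where
  identity : y * (x * a′) + z * a ≡ 1 + x * y * a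
  identity = begin
    y * (x * a′) + z * a         ≡⟨ cong (_+_ (y * (x * a′))) 1+xy≡za ⟨
    y * (x * a′) + (1 + x * y)   ≡⟨ ring x y a′ ⟩
    1 + x * y * a                ∎
    where
    ring : ∀ x y a′ → y * (x * a′) + (1 + x * y) ≡ 1 + x * y * suc a′
    ring = ℕ-solve

inverse-% : ∀ {a y k} .{{_ : NonZero a}} → y * k ≡ 1 [mod a ] → y * (k % a) ≡ 1 [mod a ]
inverse-% {a} {y} {k} yk≡1 = to (+-multiple-≡-mod⇔ (y * (k % a)) (y * (k / a)) a 1)
  (subst (λ w → w ≡ 1 [mod a ]) (sym split) yk≡1)
  where
  split : y * (k % a) + y * (k / a) * a ≡ y * k
  split = begin
    y * (k % a) + y * (k / a) * a   ≡⟨ cong (_+_ (y * (k % a))) (*-assoc y (k / a) a) ⟩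
    y * (k % a) + y * (k / a * a)   ≡⟨ *-distribˡ-+ y (k % a) (k / a * a) ⟨
    y * (k % a + k / a * a)         ≡⟨ cong (y *_) (m≡m%n+[m/n]*n k a) ⟨
    y * k                           ∎

-- (a - k)(a - b) + (b + k) a = b k + a a, with u = a - k and v = a - b so that no
-- truncated subtraction occurs.
complement-identity : ∀ {a b k u v} → u + k ≡ a → v + b ≡ a →
                      u * v + (b + k) * a ≡ b * k + a * a
complement-identity {a} {b} {k} {u} {v} u+k≡a v+b≡a = begin
  u * v + (b + k) * a                   ≡⟨ cong (_+_ (u * v)) (*-distribʳ-+ a b k) ⟩
  u * v + (b * a + k * a)               ≡⟨ cong₂ (λ s t → u * v + (b * s + k * t)) u+k≡a v+b≡a ⟨
  u * v + (b * (u + k) + k * (v + b))   ≡⟨ ring u v b k ⟩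
  b * k + (u + k) * (v + b)             ≡⟨ cong₂ (λ s t → b * k + s * t) u+k≡a v+b≡a ⟩
  b * k + a * a                         ∎
  where
  ring : ∀ u v b k → u * v + (b * (u + k) + k * (v + b)) ≡ b * k + (u + k) * (v + b)
  ring = ℕ-solve

complement-inverse : ∀ {a b k u v} → u + k ≡ a → v + b ≡ a →
                     b * k ≡ 1 [mod a ] → u * v ≡ 1 [mod a ]
complement-inverse {a} {b} {k} {u} {v} u+k≡a v+b≡a bk≡1 =
  to (+-multiple-≡-mod⇔ (u * v) (b + k) a 1)
  (subst (λ w → w ≡ 1 [mod a ]) (sym (complement-identity {a} {b} {k} {u} {v} u+k≡a v+b≡a))
    (from (+-multiple-≡-mod⇔ (b * k) a a 1) bk≡1))

record IsInverseMod (a y k : ℕ) : Set where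
  constructor _,_
  field
    bound   : k < a
    inverse : y * k ≡ 1 [mod a ]

inverseMod-exists : ∀ {a y} .{{_ : NonZero a}} → Coprime y a → ∃ (IsInverseMod a y)
inverseMod-exists {a} {y} coprime =
  map (_% a) (λ {k} yk≡1 → m%n<n k a , inverse-% {a} {y} {k} yk≡1) (coprime⇒invertible coprime)

inverseMod-unique : ∀ {a y k k′} → IsInverseMod a y k → IsInverseMod a y k′ → k ≡ k′
inverseMod-unique {a} {y} {k} {k′} (k<a , yk≡1) (k′<a , yk′≡1) =
  ≡-mod⇒≡ k<a k′<a (inverses-≡-mod {a} {y} {k} {k′} yk≡1 yk′≡1)

inverseMod-complement : ∀ {a b k} → 0 < b → b ≤ a →
                        IsInverseMod a b k → IsInverseMod a (a ∸ k) (a ∸ b)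
inverseMod-complement {a} {b} {k} 0<b b≤a (k<a , bk≡1) =
  ∸-monoʳ-< 0<b b≤a , complement-inverse {a} {b} {k} (m∸n+n≡m (<⇒≤ k<a)) (m∸n+n≡m b≤a) bk≡1

div≡/ : ∀ m n .{{_ : NonZero n}} → m div n ≡ m / n
div≡/ m (suc n) = refl

*-div-cancelˡ : ∀ g x .{{_ : NonZero g}} → (g * x) div g ≡ x
*-div-cancelˡ g x = trans (div≡/ (g * x) g) (trans (/-congˡ (*-comm g x)) (m*n/n≡m x g))

≤∸1⇔< : ∀ {a k} .{{_ : NonZero a}} → k ≤ a ∸ 1 ⇔ k < a
≤∸1⇔< {suc a} = mk⇔ s≤s s≤s⁻¹

record GcdFactorisation (r m g b a : ℕ) : Set where
  field
    r≡g*b : r ≡ g * b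
    m≡g*a : m ≡ g * a
    gcd≡g : gcd r m ≡ g

gcdFactorisation : ∀ r m .{{_ : NonZero (gcd r m)}} →
                   GcdFactorisation r m (gcd r m) (r / gcd r m) (m / gcd r m)
gcdFactorisation r m = record
  { r≡g*b = sym (m*[n/m]≡n (gcd[m,n]∣m r m))
  ; m≡g*a = sym (m*[n/m]≡n (gcd[m,n]∣n r m))
  ; gcd≡g = refl
  }

coprime⇒gcdFactorisation : ∀ {r m g b a} → Coprime b a → r ≡ g * b → m ≡ g * a →
                           GcdFactorisation r m g b a
coprime⇒gcdFactorisation {r} {m} {g} {b} {a} coprime r≡g*b m≡g*a = record
  { r≡g*b = r≡g*b
  ; m≡g*a = m≡g*a
  ; gcd≡g = begin
      gcd r m               ≡⟨ cong₂ gcd r≡g*b m≡g*a ⟩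
      gcd (g * b) (g * a)   ≡⟨ c*gcd[m,n]≡gcd[cm,cn] g b a ⟨
      g * gcd b a           ≡⟨ cong (g *_) (coprime⇒gcd≡1 coprime) ⟩
      g * 1                 ≡⟨ *-identityʳ g ⟩
      g                     ∎
  }

module _ {r m g b a} .{{_ : NonZero g}} (F : GcdFactorisation r m g b a) where
  open GcdFactorisation F

  quotient≡ : m div gcd r m ≡ a
  quotient≡ = trans (cong₂ _div_ m≡g*a gcd≡g) (*-div-cancelˡ g a)

  star-m≡ : ∀ n → star-m n m r ≡ n * a
  star-m≡ n =
    trans (cong₂ _div_ (trans (cong (_* n) m≡g*a) (ring g a n)) gcd≡g) (*-div-cancelˡ g (n * a))
    where
    ring : ∀ g a n → g * a * n ≡ g * (n * a)
    ring = ℕ-solve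

  star-r≡ : ∀ n k → star-r n m r k ≡ n * (a ∸ k)
  star-r≡ n k = cong (λ q → n * (q ∸ k)) quotient≡

  IsK⇔IsInverseMod : ∀ {k} .{{_ : NonZero a}} → IsK r m k ⇔ IsInverseMod a b k
  IsK⇔IsInverseMod {k} = mk⇔
    (λ (k≤ , rk≡gcd) → to bound⇔ k≤ , to congruence⇔ rk≡gcd)
    (λ (k<a , bk≡1) → from bound⇔ k<a , from congruence⇔ bk≡1)
    where
    bound⇔ : k ≤ m div gcd r m ∸ 1 ⇔ k < a
    bound⇔ = subst (λ q → k ≤ q ∸ 1 ⇔ k < a) (sym quotient≡) ≤∸1⇔<
    congruence⇔ : r * k ≡ gcd r m [mod m ] ⇔ b * k ≡ 1 [mod a ]
    congruence⇔ = ⇔.trans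
      (≡-mod-cong (trans (cong (_* k) r≡g*b) (*-assoc g b k))
                  (trans gcd≡g (sym (*-identityʳ g))) m≡g*a)
      (≡-mod-*ˡ⇔ g)

  star-gcdFactorisation : ∀ n k → Coprime (a ∸ k) a →
                          GcdFactorisation (star-r n m r k) (star-m n m r) n (a ∸ k) a
  star-gcdFactorisation n k coprime = coprime⇒gcdFactorisation coprime (star-r≡ n k) (star-m≡ n)

proposition2p8 : (n m r : ℕ) → 1 ≤ n → 1 ≤ m → 1 ≤ r → r ≤ m →
    Σ ℕ (λ k → IsK r m k) ×
    ((k : ℕ) → IsK r m k →
      Σ ℕ (λ k' → IsK (star-r n m r k) (star-m n m r) k') ×
      ((k' : ℕ) → IsK (star-r n m r k) (star-m n m r) k' →
        (star-n (star-n n m r) (star-m n m r) (star-r n m r k) ≡ n)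
        × (star-m (star-n n m r) (star-m n m r) (star-r n m r k) ≡ m)
        × (star-r (star-n n m r) (star-m n m r) (star-r n m r k) k' ≡ r)))
proposition2p8 n m r 1≤n 1≤m 1≤r r≤m =
  map₂ (from (IsK⇔IsInverseMod F)) (inverseMod-exists (coprime-/gcd r m)) , λ k isK →
    let a∸b-inverse = inverseMod-complement 0<b b≤a (to (IsK⇔IsInverseMod F) isK)
        F*          = star-gcdFactorisation F n k (invertible⇒coprime (IsInverseMod.inverse a∸b-inverse))
    in (a ∸ b , from (IsK⇔IsInverseMod F*) a∸b-inverse) , λ k′ isK′ →
       GcdFactorisation.gcd≡g F* ,
       trans (star-m≡ F* g) (sym (GcdFactorisation.m≡g*a F)) ,
       (begin
         star-r g (star-m n m r) (star-r n m r k) k′ ≡⟨ star-r≡ F* g k′ ⟩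
         g * (a ∸ k′)       ≡⟨ cong (λ j → g * (a ∸ j))
                                 (inverseMod-unique (to (IsK⇔IsInverseMod F*) isK′) a∸b-inverse) ⟩
         g * (a ∸ (a ∸ b))  ≡⟨ cong (g *_) (m∸[m∸n]≡n b≤a) ⟩
         g * b              ≡⟨ GcdFactorisation.r≡g*b F ⟨
         r                  ∎)
  where
  instance
    n≢0 : NonZero n
    n≢0 = >-nonZero 1≤n
    m≢0 : NonZero m
    m≢0 = >-nonZero 1≤m
    r≢0 : NonZero r
    r≢0 = >-nonZero 1≤r
    g≢0 : NonZero (gcd r m)
    g≢0 = ≢-nonZero (gcd[m,n]≢0 r m (inj₂ (≢-nonZero⁻¹ m)))
    a≢0 : NonZero (m / gcd r m)
    a≢0 = ≢-nonZero (n/gcd[m,n]≢0 r m)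
  g a b : ℕ
  g = gcd r m
  a = m / g
  b = r / g
  F : GcdFactorisation r m g b a
  F = gcdFactorisation r m
  b≤a : b ≤ a
  b≤a = /-monoˡ-≤ g r≤m
  0<b : 0 < b
  0<b = m≥n⇒m/n>0 (ℕ.∣⇒≤ (gcd[m,n]∣m r m))
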